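{- Let $n\ge 2$ and let $\mathbf A_1,\dots,\mathbf A_n$ be finite algebras in $\mathcal V_3$ with $\mathbf A_1$ Jónsson trivial. Let $\mathbf S$ be a subdirect product of $\mathbf A_1,\dots,\mathbf A_n$ such that for all $1<i\le n$ the projection of $S$ onto coordinates $1$ and $i$ equals $A_1\times A_i$. Then $S=A_1\times D$, where $D=\mathrm{proj}_{\{2,\dots,n\}}(S)$.
   Context: $\mathcal V_3$ is the class of algebras $(A;p_0,p_1,p_2,p_3)$ with ternary basic operations satisfying $p_0(x,y,z)=x$, $p_3(x,y,z)=z$, $p_i(x,y,x)=x$ for all $i$, $p_0(x,x,y)=p_1(x,x,y)$, $p_2(x,x,y)=p_3(x,x,y)$, $p_1(x,y,y)=p_2(x,y,y)$; $x\cdot y=p_1(x,y,y)$. A Jónsson ideal of $\mathbf A$ is a subuniverse $Y$ with $u\cdot y\in Y$ for all $y\in Y,u\in A$; a finite $\mathbf A\in\mathcal V_3$ is Jónsson trivial if its only Jónsson ideals are $\emptyset$ and $A$. A subdirect product of $\mathbf A_1,\dots,\mathbf A_n$ is a subalgebra of $\prod\mathbf A_i$ projecting onto each $A_i$. -}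

module Defs where

open import Level using (0ℓ)
open import Data.Nat using (ℕ; zero; suc)
open import Data.Fin using (Fin; zero; suc)
open import Data.Product using (Σ; ∃; _×_; _,_; proj₁; proj₂)
open import Data.Sum using (_⊎_)
open import Data.Unit using (⊤; tt)
open import Function.Bundles using (_↔_)
open import Relation.Unary using (Pred; _∈_; _∉_)
open import Relation.Binary.PropositionalEquality using (_≡_)

record V3Algebra : Set₁ where
  field
    Carrier : Set
    p₀ p₁ p₂ p₃ : Carrier → Carrier → Carrier → Carrier
    p₀-proj : ∀ x y z → p₀ x y z ≡ x
    p₃-proj : ∀ x y z → p₃ x y z ≡ z
    p₀-id : ∀ x y → p₀ x y x ≡ x
    p₁-id : ∀ x y → p₁ x y x ≡ x
    p₂-id : ∀ x y → p₂ x y x ≡ x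
    p₃-id : ∀ x y → p₃ x y x ≡ x
    p₀p₁ : ∀ x y → p₀ x x y ≡ p₁ x x y
    p₂p₃ : ∀ x y → p₂ x x y ≡ p₃ x x y
    p₁p₂ : ∀ x y → p₁ x y y ≡ p₂ x y y

  _·_ : Carrier → Carrier → Carrier
  x · y = p₁ x y y

open V3Algebra public

Finite : Set → Set
Finite X = Σ ℕ λ k → Fin k ↔ X

IsSubuniverse : (A : V3Algebra) → Pred (Carrier A) 0ℓ → Set
IsSubuniverse A Y =
  (∀ x y z → x ∈ Y → y ∈ Y → z ∈ Y → p₀ A x y z ∈ Y) ×
  (∀ x y z → x ∈ Y → y ∈ Y → z ∈ Y → p₁ A x y z ∈ Y) ×
  (∀ x y z → x ∈ Y → y ∈ Y → z ∈ Y → p₂ A x y z ∈ Y) ×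
  (∀ x y z → x ∈ Y → y ∈ Y → z ∈ Y → p₃ A x y z ∈ Y)

IsJonssonIdeal : (A : V3Algebra) → Pred (Carrier A) 0ℓ → Set
IsJonssonIdeal A Y = IsSubuniverse A Y × (∀ u y → y ∈ Y → _·_ A u y ∈ Y)

JonssonTrivial : V3Algebra → Set₁
JonssonTrivial A = (Y : Pred (Carrier A) 0ℓ) → IsJonssonIdeal A Y →
  (∀ a → a ∉ Y) ⊎ (∀ a → a ∈ Y)

Tuple : (n : ℕ) → (Fin n → Set) → Set
Tuple zero X = ⊤
Tuple (suc n) X = X zero × Tuple n (λ i → X (suc i))

lookup : ∀ {n} {X : Fin n → Set} → Tuple n X → (i : Fin n) → X i
lookup (x , _) zero = x
lookup (_ , t) (suc i) = lookup t i

ProdCarrier : (n : ℕ) → (Fin n → V3Algebra) → Set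
ProdCarrier n A = Tuple n (λ i → Carrier (A i))

pointwise : ∀ n (A : Fin n → V3Algebra) →
  (op : ∀ i → Carrier (A i) → Carrier (A i) → Carrier (A i) → Carrier (A i)) →
  ProdCarrier n A → ProdCarrier n A → ProdCarrier n A → ProdCarrier n A
pointwise zero A op _ _ _ = tt
pointwise (suc n) A op (x , xs) (y , ys) (z , zs) =
  op zero x y z , pointwise n (λ i → A (suc i)) (λ i → op (suc i)) xs ys zs

IsProdSubuniverse : ∀ n (A : Fin n → V3Algebra) → Pred (ProdCarrier n A) 0ℓ → Set
IsProdSubuniverse n A S =
  (∀ x y z → x ∈ S → y ∈ S → z ∈ S → pointwise n A (λ i → p₀ (A i)) x y z ∈ S) ×
  (∀ x y z → x ∈ S → y ∈ S → z ∈ S → pointwise n A (λ i → p₁ (A i)) x y z ∈ S) ×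
  (∀ x y z → x ∈ S → y ∈ S → z ∈ S → pointwise n A (λ i → p₂ (A i)) x y z ∈ S) ×
  (∀ x y z → x ∈ S → y ∈ S → z ∈ S → pointwise n A (λ i → p₃ (A i)) x y z ∈ S)

coord : ∀ n (A : Fin n → V3Algebra) → ProdCarrier n A → (i : Fin n) → Carrier (A i)
coord n A s i = lookup {n} {λ k → Carrier (A k)} s i

IsSubdirect : ∀ n (A : Fin n → V3Algebra) → Pred (ProdCarrier n A) 0ℓ → Set
IsSubdirect n A S = IsProdSubuniverse n A S ×
  (∀ i (a : Carrier (A i)) → ∃ λ s → s ∈ S × coord n A s i ≡ a)

module Submission where

open import Defs
open import Level using (0ℓ)
open import Data.Nat using (ℕ; zero; suc)
open import Data.Fin using (Fin; zero; suc)
open import Data.List using (List; []; _∷_; allFin)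
open import Data.List.Membership.Propositional using () renaming (_∈_ to _∈ˡ_)
open import Data.List.Membership.Propositional.Properties using (∈-allFin)
open import Data.List.Relation.Unary.Any using (here; there)
open import Data.Product using (∃; _×_; _,_; proj₁; proj₂)
open import Data.Sum using (inj₁; inj₂)
open import Data.Empty using (⊥-elim)
open import Relation.Unary using (Pred; _∈_)
open import Relation.Binary.PropositionalEquality using (_≡_; refl; sym; cong; cong₂; subst; module ≡-Reasoning)
open import Function.Bundles using (_⇔_; mk⇔)

-- Fix d in the projection D of S onto coordinates 2..n, and let
-- F(K) ⊆ A₁ be the set of a such that some s ∈ S has s₁ = a and agrees with d
-- on the coordinates in K.  F(∅) = A₁ since S is subdirect, and F({2..n}) is
-- the fibre of S over d.  Each F(K) is a subuniverse because the operations
-- are idempotent.  If F(K) = A₁, then F(K ∪ {j}) absorbs multiplication: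
-- for u ∈ A₁ and y ∈ F(K ∪ {j}) pick t ∈ S witnessing u ∈ F(K), t′ ∈ S with
-- t′₁ = y and t′ⱼ = tⱼ (the projection onto 1, j is full) and t″ witnessing y;
-- then p₂(t, t′, t″) witnesses p₂(u, y, y) = u · y, since on j it is
-- p₂(tⱼ, tⱼ, dⱼ) = p₃(tⱼ, tⱼ, dⱼ) = dⱼ.  So F(K ∪ {j}) is a nonempty Jónsson
-- ideal, hence all of A₁, and by induction F({2..n}) = A₁.

lookup-extensionality : ∀ n {X : Fin n → Set} (s t : Tuple n X) →
  (∀ i → lookup s i ≡ lookup t i) → s ≡ t
lookup-extensionality zero s t _ = refl
lookup-extensionality (suc n) (x , s) (y , t) eq =
  cong₂ _,_ (eq zero) (lookup-extensionality n s t (λ i → eq (suc i)))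

coord-pointwise : ∀ n (A : Fin n → V3Algebra) op x y z i →
  coord n A (pointwise n A op x y z) i ≡ op i (coord n A x i) (coord n A y i) (coord n A z i)
coord-pointwise (suc n) A op (x , xs) (y , ys) (z , zs) zero = refl
coord-pointwise (suc n) A op (x , xs) (y , ys) (z , zs) (suc i) =
  coord-pointwise n (λ k → A (suc k)) (λ k → op (suc k)) xs ys zs i

module _ (m : ℕ) (A : Fin (suc (suc m)) → V3Algebra)
  (S : Pred (ProdCarrier (suc (suc m)) A) 0ℓ) (S-subdirect : IsSubdirect (suc (suc m)) A S)
  where

  private
    A₁ : Set
    A₁ = Carrier (A zero)

    Tail : Set
    Tail = ProdCarrier (suc m) (λ j → A (suc j))

    c : ProdCarrier (suc (suc m)) A → (i : Fin (suc (suc m))) → Carrier (A i)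
    c = coord (suc (suc m)) A

    c′ : Tail → (j : Fin (suc m)) → Carrier (A (suc j))
    c′ = coord (suc m) (λ j → A (suc j))

    Operation : Set
    Operation = ∀ i → Carrier (A i) → Carrier (A i) → Carrier (A i) → Carrier (A i)

    S-closed : Operation → Set
    S-closed op = ∀ x y z → x ∈ S → y ∈ S → z ∈ S → pointwise (suc (suc m)) A op x y z ∈ S

    p₀-closed : S-closed (λ i → p₀ (A i))
    p₀-closed = proj₁ (proj₁ S-subdirect)

    p₁-closed : S-closed (λ i → p₁ (A i))
    p₁-closed = proj₁ (proj₂ (proj₁ S-subdirect))

    p₂-closed : S-closed (λ i → p₂ (A i))
    p₂-closed = proj₁ (proj₂ (proj₂ (proj₁ S-subdirect)))

    p₃-closed : S-closed (λ i → p₃ (A i))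
    p₃-closed = proj₂ (proj₂ (proj₂ (proj₁ S-subdirect)))

  ProjectionFull : Fin (suc m) → Set
  ProjectionFull j = ∀ a b → ∃ λ s → s ∈ S × c s zero ≡ a × c s (suc j) ≡ b

  fibre : List (Fin (suc m)) → Tail → Pred A₁ 0ℓ
  fibre ks d a = ∃ λ s → s ∈ S × c s zero ≡ a × (∀ {j} → j ∈ˡ ks → c s (suc j) ≡ c′ d j)

  fibre-closed : ∀ ks d (op : Operation) → (∀ i x → op i x x x ≡ x) → S-closed op →
    ∀ x y z → x ∈ fibre ks d → y ∈ fibre ks d → z ∈ fibre ks d → op zero x y z ∈ fibre ks d
  fibre-closed ks d op idem closed _ _ _ (s₁ , s₁∈S , refl , agree₁) (s₂ , s₂∈S , refl , agree₂)
    (s₃ , s₃∈S , refl , agree₃) =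
    t , closed s₁ s₂ s₃ s₁∈S s₂∈S s₃∈S , coord-pointwise _ A op s₁ s₂ s₃ zero , agree
    where
    t = pointwise (suc (suc m)) A op s₁ s₂ s₃
    agree : ∀ {j} → j ∈ˡ ks → c t (suc j) ≡ c′ d j
    agree {j} j∈ks = begin
      c t (suc j)                                  ≡⟨ coord-pointwise _ A op s₁ s₂ s₃ (suc j) ⟩
      op (suc j) (c s₁ (suc j)) (c s₂ (suc j)) (c s₃ (suc j))
        ≡⟨ cong₂ (λ u w → op (suc j) u w (c s₃ (suc j))) (agree₁ j∈ks) (agree₂ j∈ks) ⟩
      op (suc j) (c′ d j) (c′ d j) (c s₃ (suc j)) ≡⟨ cong (op (suc j) (c′ d j) (c′ d j)) (agree₃ j∈ks) ⟩
      op (suc j) (c′ d j) (c′ d j) (c′ d j)       ≡⟨ idem (suc j) (c′ d j) ⟩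
      c′ d j                                      ∎
      where open ≡-Reasoning

  fibre-isSubuniverse : ∀ ks d → IsSubuniverse (A zero) (fibre ks d)
  fibre-isSubuniverse ks d =
    fibre-closed ks d (λ i → p₀ (A i)) (λ i x → p₀-id (A i) x x) p₀-closed ,
    fibre-closed ks d (λ i → p₁ (A i)) (λ i x → p₁-id (A i) x x) p₁-closed ,
    fibre-closed ks d (λ i → p₂ (A i)) (λ i x → p₂-id (A i) x x) p₂-closed ,
    fibre-closed ks d (λ i → p₃ (A i)) (λ i x → p₃-id (A i) x x) p₃-closed

  fibre-absorbs : ∀ j ks d →
    ProjectionFull j → (∀ u → u ∈ fibre ks d) →
    ∀ u y → y ∈ fibre (j ∷ ks) d → _·_ (A zero) u y ∈ fibre (j ∷ ks) d
  fibre-absorbs j ks d full₁ⱼ fibre-ks-total u y (t″ , t″∈S , t″₁≡y , agree″)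
    with fibre-ks-total u
  ... | t , t∈S , t₁≡u , agree
    with full₁ⱼ y (c t (suc j))
  ... | t′ , t′∈S , t′₁≡y , t′ⱼ≡tⱼ =
    w , p₂-closed t t′ t″ t∈S t′∈S t″∈S , w₁≡u·y , agree-w
    where
    p₂ᵢ = λ i → p₂ (A i)
    w = pointwise (suc (suc m)) A p₂ᵢ t t′ t″
    open ≡-Reasoning

    w₁≡u·y : c w zero ≡ _·_ (A zero) u y
    w₁≡u·y = begin
      c w zero                                ≡⟨ coord-pointwise _ A p₂ᵢ t t′ t″ zero ⟩
      p₂ (A zero) (c t zero) (c t′ zero) (c t″ zero)
        ≡⟨ cong₂ (λ a b → p₂ (A zero) a b (c t″ zero)) t₁≡u t′₁≡y ⟩
      p₂ (A zero) u y (c t″ zero)             ≡⟨ cong (p₂ (A zero) u y) t″₁≡y ⟩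
      p₂ (A zero) u y y                       ≡⟨ sym (p₁p₂ (A zero) u y) ⟩
      _·_ (A zero) u y                        ∎

    agree-w : ∀ {k} → k ∈ˡ j ∷ ks → c w (suc k) ≡ c′ d k
    agree-w (here refl) = begin
      c w (suc j)                             ≡⟨ coord-pointwise _ A p₂ᵢ t t′ t″ (suc j) ⟩
      p₂ (A (suc j)) (c t (suc j)) (c t′ (suc j)) (c t″ (suc j))
        ≡⟨ cong₂ (p₂ (A (suc j)) (c t (suc j))) t′ⱼ≡tⱼ (agree″ (here refl)) ⟩
      p₂ (A (suc j)) (c t (suc j)) (c t (suc j)) (c′ d j) ≡⟨ p₂p₃ (A (suc j)) _ _ ⟩
      p₃ (A (suc j)) (c t (suc j)) (c t (suc j)) (c′ d j) ≡⟨ p₃-proj (A (suc j)) _ _ _ ⟩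
      c′ d j                                  ∎
    agree-w {k} (there k∈ks) = begin
      c w (suc k)                             ≡⟨ coord-pointwise _ A p₂ᵢ t t′ t″ (suc k) ⟩
      p₂ (A (suc k)) (c t (suc k)) (c t′ (suc k)) (c t″ (suc k))
        ≡⟨ cong₂ (λ a b → p₂ (A (suc k)) a (c t′ (suc k)) b) (agree k∈ks) (agree″ (there k∈ks)) ⟩
      p₂ (A (suc k)) (c′ d k) (c t′ (suc k)) (c′ d k) ≡⟨ p₂-id (A (suc k)) _ _ ⟩
      c′ d k                                  ∎

  fibre-total : JonssonTrivial (A zero) → (∀ j → ProjectionFull j) →
    ∀ ks d → (∃ λ a′ → (a′ , d) ∈ S) → ∀ u → u ∈ fibre ks d
  fibre-total _ _ [] d _ u with proj₂ S-subdirect zero u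
  ... | s , s∈S , s₁≡u = s , s∈S , s₁≡u , λ ()
  fibre-total trivial full (j ∷ ks) d (a′ , a′d∈S) u
    with trivial (fibre (j ∷ ks) d)
           (fibre-isSubuniverse (j ∷ ks) d ,
            fibre-absorbs j ks d (full j) (fibre-total trivial full ks d (a′ , a′d∈S)))
  ... | inj₁ empty = ⊥-elim (empty a′ ((a′ , d) , a′d∈S , refl , λ _ → refl))
  ... | inj₂ total = total u

  fibre-allFin⇒∈S : ∀ d a → a ∈ fibre (allFin (suc m)) d → (a , d) ∈ S
  fibre-allFin⇒∈S d a (s , s∈S , s₁≡a , agree) = subst (_∈ S) s≡ad s∈S
    where
    s≡ad : s ≡ (a , d)
    s≡ad = lookup-extensionality (suc (suc m)) {λ i → Carrier (A i)} s (a , d) λ where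
      zero    → s₁≡a
      (suc j) → agree (∈-allFin j)

lemma3p9 : (m : ℕ) (A : Fin (suc (suc m)) → V3Algebra) →
    (∀ i → Finite (Carrier (A i))) →
    JonssonTrivial (A zero) →
    (S : Pred (ProdCarrier (suc (suc m)) A) 0ℓ) →
    IsSubdirect (suc (suc m)) A S →
    (∀ (j : Fin (suc m)) (a : Carrier (A zero)) (b : Carrier (A (suc j))) →
      ∃ λ s → s ∈ S × coord (suc (suc m)) A s zero ≡ a × coord (suc (suc m)) A s (suc j) ≡ b) →
    ∀ (a : Carrier (A zero)) (d : ProdCarrier (suc m) (λ j → A (suc j))) →
      ((a , d) ∈ S ⇔ (∃ λ a′ → (a′ , d) ∈ S))
lemma3p9 m A _ trivial S S-subdirect full a d = mk⇔ (a ,_) λ d∈D →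
  fibre-allFin⇒∈S m A S S-subdirect d a
    (fibre-total m A S S-subdirect trivial full (allFin (suc m)) d d∈D a)
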